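{- Let $T$ be a normal standard finite tree, $A \subseteq \omega_2$ finite, and $\{f_\xi : \xi \in A\}$ a family of standard functions on $T$. Assume: $\alpha < \beta$ are in $\mathrm{ht}[T]$; $X \subseteq T_\alpha$; $\{f_\xi : \xi \in A\}$ is separated on $X$; and whenever $f_\tau(x) = y$ with $x, y \in X$ and $\tau \in A$, then $\mathrm{Succ}_T(x) \subseteq \mathrm{dom}(f_\tau)$ and $\mathrm{Succ}_T(y) \subseteq \mathrm{ran}(f_\tau)$. Then for every $b \in T_\beta$ with $b \upharpoonright \alpha \in X$ there is a set $Y \subseteq T_\beta$ which has unique drop-downs to $\alpha$, satisfies $Y \upharpoonright \alpha = X$ and $b \in Y$, and such that for all $\tau \in A$, $X$ and $Y$ are $f_\tau$-consistent.
   Context: Heights: for a countable ordinal $\gamma$, $\mathrm{ht}(\gamma)$ is the unique $\alpha$ with $\omega\cdot\alpha \le \gamma < \omega\cdot(\alpha+1)$. Standard finite tree: a pair $(T,<_T)$ with (1) $T$ a finite subset of $\{0\}\cup(\omega_1\setminus\omega)$, $0 \in T$; (2) $<_T$ a strict partial order on $T$ such that $\{y : y <_T x\}$ is linearly ordered for each $x$; (3) $x <_T y$ implies $\mathrm{ht}(x) < \mathrm{ht}(y)$; (4) for all $x \in T$ and all $\alpha \in \{\mathrm{ht}(z): z \in T\} \cap \mathrm{ht}(x)$ there is $y <_T x$ with $\mathrm{ht}(y)=\alpha$. Let $\mathrm{ht}[T] = \{\mathrm{ht}(x) : x \in T\}\setminus\{0\}$, $T_\alpha = \{x \in T : \mathrm{ht}(x)=\alpha\}$;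 for $x \in T_\alpha$ and $\beta \in (\mathrm{ht}[T]\cup\{0\}) \cap \alpha$, $x \upharpoonright \beta$ is the unique $y \in T_\beta$ with $y <_T x$; for $Y\subseteq T_\alpha$, $Y\upharpoonright\beta=\{y\upharpoonright\beta : y\in Y\}$, and $Y$ has unique drop-downs to $\beta$ if $y\mapsto y\upharpoonright\beta$ is injective on $Y$. $\mathrm{Succ}_T(x)=\{y\in T : x<_T y\}$. $T$ is normal if for every $x\in T$ and every $\gamma\in\mathrm{ht}[T]$ with $\gamma>\mathrm{ht}(x)$ there is $y\in T_\gamma$ with $x<_T y$. Standard function on $T$: a partial function $f$ from $T$ to $T$ which is injective, strictly increasing, level preserving, downwards closed ($x \in \mathrm{dom}(f)$, $\beta \in \mathrm{ht}[T]\cap\mathrm{ht}(x)$ imply $x\upharpoonright\beta\in\mathrm{dom}(f)$), with $f(x)\ne x$ for $x\in\mathrm{dom}(f)\setminus\{0\}$. $f^1=f$, $f^{ -1}$ is the inverse partial function. Consistency: for $\gamma<\delta$ in $\mathrm{ht}[T]$ and $Y\subseteq T_\delta$ with unique drop-downs to $\gamma$, $Y\upharpoonright\gamma$ and $Y$ are $f$-consistent if for all $x,y\in Y$: $f(x\upharpoonright\gamma)=y\upharpoonright\gamma$ iff $f(x)=y$. Separation: for distinct $a_0,\dots,a_{n-1}\in T_\alpha$, $\{f_\xi:\xi\in A\}$ is separated on $(a_0,\dots,a_{n-1})$ if for every $i<n$ there is at most one triple $(j,m,\tau)$ with $j<i$, $m\in\{ -1,1\}$, $\tau\in A$, $f_\tau^m(a_i)=a_j$.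 It is separated on $X\subseteq T_\alpha$ if it is separated on some injective tuple listing $X$. -}

module Defs where

open import Data.Nat using (ℕ)
open import Data.Fin using (Fin) renaming (_<_ to _<ᶠ_)
open import Data.Product using (Σ; ∃; ∃-syntax; _×_; _,_; proj₁)
open import Data.Sum using (_⊎_)
open import Data.List using (List)
open import Data.List.Membership.Propositional using (_∈_)
open import Relation.Nullary using (¬_)
open import Relation.Binary.PropositionalEquality using (_≡_)
open import Relation.Binary.Structures using (IsStrictTotalOrder)
open import Function.Definitions using (Injective)

-- In the paper the heights ht(γ) of countable ordinals are
-- countable ordinals, ordered linearly, with least element 0.  We
-- abstract this as a strict total order (H, <) with a least element h0;
-- the paper's setting is the instance H = ω₁, h0 = 0.

record Heights : Set₁ where
  field
    H        : Set
    _<_      : H → H → Set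
    isSTO    : IsStrictTotalOrder _≡_ _<_
    h0       : H
    h0-least : ∀ h → h ≡ h0 ⊎ h0 < h

module Tree (𝓗 : Heights) where
  open Heights 𝓗

  -- Nodes.  A countable ordinal γ ∈ {0} ∪ (ω₁ ∖ ω) is coded as follows:
  -- γ = ω·α + n (α ≥ 1) is the pair (α , n), and 0 is root = (h0 , 0).
  -- Then ht(γ) = α is the first projection.
  Node : Set
  Node = H × ℕ

  ht : Node → H
  ht = proj₁

  root : Node
  root = (h0 , 0)

  -- A standard finite tree: T is a finite list of nodes, and the order
  -- <_T is given by the finite list R of pairs (x , y) with x <_T y.
  record IsStdTree (T : List Node) (R : List (Node × Node)) : Set where
    field
      nodes-ok : ∀ {x} → x ∈ T → x ≡ root ⊎ ¬ (ht x ≡ h0)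
      root-in  : root ∈ T
      rel-in   : ∀ {x y} → (x , y) ∈ R → x ∈ T × y ∈ T
      irrefl   : ∀ {x} → ¬ ((x , x) ∈ R)
      trans    : ∀ {x y z} → (x , y) ∈ R → (y , z) ∈ R → (x , z) ∈ R
      linear   : ∀ {x y z} → (y , x) ∈ R → (z , x) ∈ R →
                 (y , z) ∈ R ⊎ y ≡ z ⊎ (z , y) ∈ R
      ht-mono  : ∀ {x y} → (x , y) ∈ R → ht x < ht y
      full     : ∀ {x z} → x ∈ T → z ∈ T → ht z < ht x →
                 ∃[ y ] ((y , x) ∈ R × ht y ≡ ht z)

  InHt : List Node → H → Set
  InHt T γ = (∃[ z ] (z ∈ T × ht z ≡ γ)) × ¬ (γ ≡ h0)

  Level : List Node → H → Node → Set
  Level T α x = x ∈ T × ht x ≡ α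

  Restr : List Node → List (Node × Node) → Node → H → Node → Set
  Restr T R x β y = y ∈ T × ht y ≡ β × (y , x) ∈ R

  IsNormal : List Node → List (Node × Node) → Set
  IsNormal T R = ∀ {x γ} → x ∈ T → InHt T γ → ht x < γ →
                 ∃[ y ] (Level T γ y × (x , y) ∈ R)

  -- Standard functions, given by their finite graph F (pairs (x , f x)).
  record IsStdFun (T : List Node) (R : List (Node × Node))
                  (F : List (Node × Node)) : Set where
    field
      in-T       : ∀ {x y} → (x , y) ∈ F → x ∈ T × y ∈ T
      functional : ∀ {x y y'} → (x , y) ∈ F → (x , y') ∈ F → y ≡ y'
      injective  : ∀ {x x' y} → (x , y) ∈ F → (x' , y) ∈ F → x ≡ x'
      increasing : ∀ {x x' y y'} → (x , y) ∈ F → (x' , y') ∈ F →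
                   (x , x') ∈ R → (y , y') ∈ R
      level      : ∀ {x y} → (x , y) ∈ F → ht x ≡ ht y
      down-closed : ∀ {x y β z} → (x , y) ∈ F → InHt T β → β < ht x →
                    Restr T R x β z → ∃[ w ] ((z , w) ∈ F)
      no-fix     : ∀ {x y} → (x , y) ∈ F → ¬ (x ≡ root) → ¬ (y ≡ x)

  data Exp : Set where
    minus plus : Exp

  App : List (Node × Node) → Exp → Node → Node → Set
  App F plus  a b = (a , b) ∈ F
  App F minus a b = (b , a) ∈ F

  -- Separation.  The finite index set A ⊆ ω₂ is represented by Fin k.
  SeparatedTuple : {k : ℕ} → (Fin k → List (Node × Node)) →
                   (n : ℕ) → (Fin n → Node) → Set
  SeparatedTuple {k} f n a =
    ∀ (i : Fin n) (t t' : Fin n × Exp × Fin k) →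
      Triple i t → Triple i t' → t ≡ t'
    where
      Triple : Fin n → Fin n × Exp × Fin k → Set
      Triple i (j , m , τ) = j <ᶠ i × App (f τ) m (a i) (a j)

  Separated : {k : ℕ} → (Fin k → List (Node × Node)) → List Node → Set
  Separated f X =
    Σ ℕ λ n → Σ (Fin n → Node) λ a →
      Injective _≡_ _≡_ a ×
      (∀ x → (x ∈ X → ∃[ i ] (a i ≡ x)) × (∃[ i ] (a i ≡ x) → x ∈ X)) ×
      SeparatedTuple f n a

  UniqueDrop : List Node → List (Node × Node) → H → List Node → Set
  UniqueDrop T R γ Y = ∀ {y y' c} → y ∈ Y → y' ∈ Y →
                       Restr T R y γ c → Restr T R y' γ c → y ≡ y'

  RestrEq : List Node → List (Node × Node) → H → List Node → List Node → Set
  RestrEq T R γ Y X = ∀ c → (c ∈ X → ∃[ y ] (y ∈ Y × Restr T R y γ c)) ×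
                            (∃[ y ] (y ∈ Y × Restr T R y γ c) → c ∈ X)

  Consistent : List Node → List (Node × Node) → H → List (Node × Node) →
               List Node → Set
  Consistent T R γ F Y = ∀ {x y cx cy} → x ∈ Y → y ∈ Y →
    Restr T R x γ cx → Restr T R y γ cy →
    ((cx , cy) ∈ F → (x , y) ∈ F) × ((x , y) ∈ F → (cx , cy) ∈ F)

-- List X as a₀, …, a_{N-1} so that the family is separated on this tuple:
-- every aᵢ is joined to an earlier aⱼ by at most one f_τ^{±1}.  Choose lifts
-- gᵢ ∈ T_β over aᵢ in the order of the indices.  If aᵢ has such an earlier
-- partner aⱼ, the succession hypothesis lets f_τ^{±1} carry gⱼ to a node over
-- aᵢ, and this is the only f-edge from aᵢ into the earlier nodes that gᵢ must
-- respect; otherwise normality provides any node over aᵢ.  To force b = g_{i₀},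
-- the lift at i₀ is fixed first and, when a_{i₀} has a partner aⱼ, pushed down
-- to a prescribed lift over aⱼ, recursively.  Consistency in the other
-- direction holds for any lifts, since standard functions commute with ↾ α.

module Submission where

open import Defs
open import Data.Nat using (ℕ; zero; suc; _≤_) renaming (_<_ to _<ℕ_; _≟_ to _≟ℕ_)
open import Data.Nat.Properties using (<⇒≤; <-irrefl; ≤-refl; m<1+n⇒m<n∨m≡n; _<?_)
open import Data.Fin using (Fin; toℕ; fromℕ<) renaming (_<_ to _<ᶠ_)
open import Data.Fin.Properties using (toℕ-injective; toℕ<n; toℕ-fromℕ<; any?) renaming (_≟_ to _≟ᶠ_)
open import Data.Product using (∃; ∃-syntax; _×_; _,_; proj₁; proj₂)
open import Data.Product.Properties using (≡-dec)
open import Data.Sum using (_⊎_; inj₁; inj₂; [_,_])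
open import Data.Empty using (⊥-elim)
open import Data.List using (List; map; allFin)
open import Data.List.Membership.Propositional using (_∈_)
open import Data.List.Membership.Propositional.Properties using (∈-map⁺; ∈-map⁻; ∈-allFin)
import Data.List.Membership.DecPropositional as DecMembership
open import Data.Vec.Functional using (updateAt)
open import Data.Vec.Functional.Properties using (updateAt-updates; updateAt-minimal)
open import Function using (const)
open import Function.Definitions using (Injective)
open import Relation.Nullary using (¬_; Dec; yes; no)
open import Relation.Nullary.Decidable using (_×-dec_; _⊎-dec_; map′)
open import Relation.Binary.PropositionalEquality using (_≡_; _≢_; refl; sym; trans; cong; subst)
open import Relation.Binary.Structures using (IsStrictTotalOrder)

module Lifting (𝓗 : Heights) where
  open Heights 𝓗
  open Tree 𝓗
  open IsStrictTotalOrder isSTO using (irrefl) renaming (_≟_ to _≟ᴴ_)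

  module StdTreeProperties {T : List Node} {R : List (Node × Node)} (st : IsStdTree T R) where
    open IsStdTree st using (rel-in; linear; ht-mono; full)

    restrict-unique : ∀ {x γ c c'} → Restr T R x γ c → Restr T R x γ c' → c ≡ c'
    restrict-unique (_ , hc , cx) (_ , hc' , c'x) with linear cx c'x
    ... | inj₁ cc'        = ⊥-elim (irrefl (trans hc (sym hc')) (ht-mono cc'))
    ... | inj₂ (inj₁ c≡c') = c≡c'
    ... | inj₂ (inj₂ c'c) = ⊥-elim (irrefl (trans hc' (sym hc)) (ht-mono c'c))

    restrict-exists : ∀ {x γ} → InHt T γ → x ∈ T → γ < ht x → ∃[ c ] Restr T R x γ c
    restrict-exists ((z , z∈T , refl) , _) x∈T z<x with full x∈T z∈T z<x
    ... | c , cx , hc = c , proj₁ (rel-in cx) , hc , cx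

  module StdFunProperties {T : List Node} {R : List (Node × Node)} (st : IsStdTree T R)
                          {F : List (Node × Node)} (sf : IsStdFun T R F) where
    open IsStdFun sf
    open StdTreeProperties st

    image-level : ∀ {x y γ} → (x , y) ∈ F → Level T γ x → Level T γ y
    image-level xy (_ , hx) = proj₂ (in-T xy) , trans (sym (level xy)) hx

    preimage-level : ∀ {x y γ} → (x , y) ∈ F → Level T γ y → Level T γ x
    preimage-level xy (_ , hy) = proj₁ (in-T xy) , trans (level xy) hy

    restrict-app : ∀ {x y γ c d} → InHt T γ → γ < ht x → (x , y) ∈ F →
                   Restr T R x γ c → Restr T R y γ d → (c , d) ∈ F
    restrict-app {y = y} iγ γ<x xy x↾γ@(_ , hc , cx) y↾γ with down-closed xy iγ γ<x x↾γ
    ... | w , cw = subst (λ z → (_ , z) ∈ F) (restrict-unique w↾γ y↾γ) cw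
      where
        w↾γ : Restr T R y _ w
        w↾γ = proj₂ (in-T cw) , trans (sym (level cw)) hc , increasing cw xy cx

    restrict-app-forward : ∀ {u v γ c d} → InHt T γ → γ < ht u → (u , v) ∈ F →
                           Restr T R u γ c → (c , d) ∈ F → Restr T R v γ d
    restrict-app-forward iγ γ<u uv u↾γ@(_ , hc , cu) cd with down-closed uv iγ γ<u u↾γ
    ... | w , cw with functional cw cd
    ... | refl = proj₂ (in-T cd) , trans (sym (level cd)) hc , increasing cd uv cu

    restrict-app-backward : ∀ {u v γ c d} → InHt T γ → γ < ht v → (u , v) ∈ F →
                            Restr T R v γ d → (c , d) ∈ F → Restr T R u γ c
    restrict-app-backward {u} {γ = γ} iγ γ<v uv v↾γ cd =
      let _ , u↾γ = restrict-exists iγ (proj₁ (in-T uv)) γ<u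
      in subst (Restr T R u γ) (injective (restrict-app iγ γ<u uv u↾γ v↾γ) cd) u↾γ
      where
        γ<u : γ < ht u
        γ<u = subst (γ <_) (sym (level uv)) γ<v

  _≟ₙ_ : (x y : Node) → Dec (x ≡ y)
  _≟ₙ_ = ≡-dec _≟ᴴ_ _≟ℕ_

  open DecMembership (≡-dec _≟ₙ_ _≟ₙ_) using (_∈?_)

  App? : ∀ F m x y → Dec (App F m x y)
  App? F plus  x y = (x , y) ∈? F
  App? F minus x y = (y , x) ∈? F

  any-Exp? : {P : Exp → Set} → Dec (P minus) → Dec (P plus) → Dec (∃ P)
  any-Exp? p? q? = map′ [ (minus ,_) , (plus ,_) ]
                        (λ { (minus , p) → inj₁ p ; (plus , p) → inj₂ p }) (p? ⊎-dec q?)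

  module Construction
    (T : List Node) (R : List (Node × Node)) (st : IsStdTree T R) (normal : IsNormal T R)
    {k : ℕ} (f : Fin k → List (Node × Node)) (sf : ∀ τ → IsStdFun T R (f τ))
    {α β : H} (iα : InHt T α) (iβ : InHt T β) (α<β : α < β)
    (X : List Node) (X-level : ∀ {x} → x ∈ X → Level T α x)
    (succ-in-dom-ran : ∀ τ {x y} → x ∈ X → y ∈ X → (x , y) ∈ f τ →
      (∀ {z} → (x , z) ∈ R → ∃[ w ] ((z , w) ∈ f τ)) ×
      (∀ {z} → (y , z) ∈ R → ∃[ w ] ((w , z) ∈ f τ)))
    {N : ℕ} (a : Fin N → Node)
    (a-enumerates : ∀ x → (x ∈ X → ∃[ i ] (a i ≡ x)) × (∃[ i ] (a i ≡ x) → x ∈ X))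
    (separated : SeparatedTuple f N a)
    where
    open StdTreeProperties st
    module F (τ : Fin k) = StdFunProperties st (sf τ)

    a∈X : ∀ i → a i ∈ X
    a∈X i = proj₂ (a-enumerates (a i)) (i , refl)

    a-level : ∀ i → Level T α (a i)
    a-level i = X-level (a∈X i)

    a≢root : ∀ i → a i ≢ root
    a≢root i a≡root = proj₂ iα (trans (sym (proj₂ (a-level i))) (cong ht a≡root))

    Above : Fin N → Node → Set
    Above i u = Level T β u × Restr T R u α (a i)

    α<ht : ∀ {u} → Level T β u → α < ht u
    α<ht (_ , refl) = α<β

    lift-app : ∀ {i j τ} m {u} → App (f τ) m (a i) (a j) → Above i u →
               ∃[ w ] (App (f τ) m u w × Above j w)
    lift-app {i} {j} {τ} plus ai↦aj (u-level , u↾α@(_ , _ , ai<u))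
      with proj₁ (succ-in-dom-ran τ (a∈X i) (a∈X j) ai↦aj) ai<u
    ... | w , u↦w = w , u↦w , F.image-level τ u↦w u-level ,
                    F.restrict-app-forward τ iα (α<ht u-level) u↦w u↾α ai↦aj
    lift-app {i} {j} {τ} minus aj↦ai (u-level , u↾α@(_ , _ , ai<u))
      with proj₂ (succ-in-dom-ran τ (a∈X j) (a∈X i) aj↦ai) ai<u
    ... | w , w↦u = w , w↦u , F.preimage-level τ w↦u u-level ,
                    F.restrict-app-backward τ iα (α<ht u-level) w↦u u↾α aj↦ai

    lift-app⁻¹ : ∀ {i j τ} m {u} → App (f τ) m (a i) (a j) → Above j u →
                 ∃[ w ] (App (f τ) m w u × Above i w)
    lift-app⁻¹ plus  = lift-app minus
    lift-app⁻¹ minus = lift-app plus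

    Parent : Fin N → Fin N × Exp × Fin k → Set
    Parent i (j , m , τ) = j <ᶠ i × App (f τ) m (a i) (a j)

    HasParent : Fin N → Set
    HasParent i = ∃[ j ] ∃[ m ] ∃[ τ ] Parent i (j , m , τ)

    parent? : ∀ i → Dec (HasParent i)
    parent? i = any? λ j → any-Exp?
      (any? λ τ → (toℕ j <? toℕ i) ×-dec App? (f τ) minus (a i) (a j))
      (any? λ τ → (toℕ j <? toℕ i) ×-dec App? (f τ) plus (a i) (a j))

    record Lift (n : ℕ) (g : Fin N → Node) : Set where
      field
        above      : ∀ i → toℕ i <ℕ n → Above i (g i)
        consistent : ∀ τ p q → toℕ p <ℕ n → toℕ q <ℕ n →
                     (a p , a q) ∈ f τ → (g p , g q) ∈ f τ

    Anchored : ℕ → Fin N → Node → (Fin N → Node) → Set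
    Anchored n i₀ b g = toℕ i₀ <ℕ n → g i₀ ≡ b

    AnchoredLifts : ℕ → Set
    AnchoredLifts n = ∀ i₀ {b} → Above i₀ b → ∃[ g ] (Lift n g × Anchored n i₀ b g)

    module Step {n : ℕ} (n<N : n <ℕ N) where
      ι : Fin N
      ι = fromℕ< n<N

      toℕ-ι : toℕ ι ≡ n
      toℕ-ι = toℕ-fromℕ< n<N

      below⇒≢ι : ∀ {i} → toℕ i <ℕ n → i ≢ ι
      below⇒≢ι i<n refl = <-irrefl toℕ-ι i<n

      below⇒<ι : ∀ {i : Fin N} → toℕ i <ℕ n → i <ᶠ ι
      below⇒<ι {i} = subst (toℕ i <ℕ_) (sym toℕ-ι)

      <ι⇒below : ∀ {i : Fin N} → i <ᶠ ι → toℕ i <ℕ n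
      <ι⇒below {i} = subst (toℕ i <ℕ_) toℕ-ι

      ι-or-below : ∀ {i} → toℕ i <ℕ suc n → i ≡ ι ⊎ toℕ i <ℕ n
      ι-or-below i<1+n with m<1+n⇒m<n∨m≡n i<1+n
      ... | inj₁ i<n = inj₂ i<n
      ... | inj₂ i≡n = inj₁ (toℕ-injective (trans i≡n (sym toℕ-ι)))

      Compatible : Node → (Fin N → Node) → Set
      Compatible v g = ∀ {j m τ} → Parent ι (j , m , τ) → App (f τ) m v (g j)

      compatible-parent : ∀ {j m τ v g} → Parent ι (j , m , τ) → App (f τ) m v (g j) →
                          Compatible v g
      compatible-parent p v↦gj p′ with separated ι _ _ p′ p
      ... | refl = v↦gj

      compatible-orphan : ∀ {v g} → ¬ HasParent ι → Compatible v g
      compatible-orphan ¬p {j} {m} {τ} p = ⊥-elim (¬p (j , m , τ , p))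

      _[ι]≔_ : (Fin N → Node) → Node → Fin N → Node
      g [ι]≔ v = updateAt g ι (const v)

      extend : ∀ {g v} → Lift n g → Above ι v → Compatible v g → Lift (suc n) (g [ι]≔ v)
      extend {g} {v} L v-above compatible = record { above = above′ ; consistent = consistent′ }
        where
          open Lift L
          at-ι : (g [ι]≔ v) ι ≡ v
          at-ι = updateAt-updates ι g
          at-below : ∀ {i} → toℕ i <ℕ n → (g [ι]≔ v) i ≡ g i
          at-below i<n = updateAt-minimal _ ι g (below⇒≢ι i<n)

          above′ : ∀ i → toℕ i <ℕ suc n → Above i ((g [ι]≔ v) i)
          above′ i i<1+n with ι-or-below i<1+n
          ... | inj₁ refl = subst (Above ι) (sym at-ι) v-above
          ... | inj₂ i<n  = subst (Above i) (sym (at-below i<n)) (above i i<n)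

          consistent′ : ∀ τ p q → toℕ p <ℕ suc n → toℕ q <ℕ suc n →
                        (a p , a q) ∈ f τ → ((g [ι]≔ v) p , (g [ι]≔ v) q) ∈ f τ
          consistent′ τ p q p< q< ap↦aq with ι-or-below p< | ι-or-below q<
          ... | inj₁ refl | inj₁ refl = ⊥-elim (IsStdFun.no-fix (sf τ) ap↦aq (a≢root ι) refl)
          ... | inj₁ refl | inj₂ q<n rewrite at-ι | at-below q<n =
                compatible {q} {plus} {τ} (below⇒<ι q<n , ap↦aq)
          ... | inj₂ p<n | inj₁ refl rewrite at-below p<n | at-ι =
                compatible {p} {minus} {τ} (below⇒<ι p<n , ap↦aq)
          ... | inj₂ p<n | inj₂ q<n rewrite at-below p<n | at-below q<n =
                consistent τ p q p<n q<n ap↦aq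

      anchored-extend : ∀ {i₀ b g v} → i₀ ≢ ι → Anchored n i₀ b g → Anchored (suc n) i₀ b (g [ι]≔ v)
      anchored-extend {i₀} {g = g} i₀≢ι anchored i₀<1+n with ι-or-below i₀<1+n
      ... | inj₁ i₀≡ι = ⊥-elim (i₀≢ι i₀≡ι)
      ... | inj₂ i₀<n = trans (updateAt-minimal i₀ ι g i₀≢ι) (anchored i₀<n)

      next-value : ∀ {g} → Lift n g → ∃[ v ] (Above ι v × Compatible v g)
      next-value {g} L with parent? ι
      ... | yes (j , m , τ , p@(j<ι , aι↦aj)) =
            let v , v↦gj , v-above = lift-app⁻¹ m aι↦aj (Lift.above L j (<ι⇒below j<ι))
            in v , v-above , compatible-parent {g = g} p v↦gj
      ... | no ¬p =
            let aι∈T , ht-aι = a-level ι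
                v , v-level , aι<v = normal aι∈T iβ (subst (_< β) (sym ht-aι) α<β)
            in v , (v-level , aι∈T , ht-aι , aι<v) , compatible-orphan {g = g} ¬p

      -- If ι has a parent j, lifting the edge from b dictates the anchor at j.
      compatible-lift : AnchoredLifts n → ∀ {b} → Above ι b → ∃[ g ] (Lift n g × Compatible b g)
      compatible-lift lifts {b} b-above with parent? ι
      ... | yes (j , m , τ , p@(j<ι , aι↦aj)) =
            let b′ , b↦b′ , b′-above = lift-app m aι↦aj b-above
                g , L , anchored = lifts j b′-above
                b↦gj = subst (App (f τ) m b) (sym (anchored (<ι⇒below j<ι))) b↦b′
            in g , L , compatible-parent {g = g} p b↦gj
      ... | no ¬p =
            let g , L , _ = lifts ι b-above
            in g , L , compatible-orphan {g = g} ¬p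

      lift-step : AnchoredLifts n → AnchoredLifts (suc n)
      lift-step lifts i₀ {b} b-above with i₀ ≟ᶠ ι
      ... | yes refl =
            let g , L , compatible = compatible-lift lifts b-above
            in g [ι]≔ b , extend L b-above compatible , λ _ → updateAt-updates ι g
      ... | no i₀≢ι =
            let g , L , anchored = lifts i₀ b-above
                v , v-above , compatible = next-value L
            in g [ι]≔ v , extend L v-above compatible , anchored-extend i₀≢ι anchored

    anchored-lifts : ∀ n → n ≤ N → AnchoredLifts n
    anchored-lifts zero    _   _ {b} _ = const b , record { above = λ _ () ; consistent = λ _ _ _ () } , λ ()
    anchored-lifts (suc n) n<N = Step.lift-step n<N (anchored-lifts n (<⇒≤ n<N))

    lifted-level-set : Injective _≡_ _≡_ a → ∀ {b} → Level T β b → ∃[ c ] (Restr T R b α c × c ∈ X) →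
                       ∃[ Y ] ((∀ {y} → y ∈ Y → Level T β y) ×
                               UniqueDrop T R α Y ×
                               RestrEq T R α Y X ×
                               b ∈ Y ×
                               (∀ τ → Consistent T R α (f τ) Y))
    lifted-level-set a-injective {b} b-level (c , b↾α , c∈X) with proj₁ (a-enumerates c) c∈X
    ... | i₀ , refl with anchored-lifts N ≤-refl i₀ (b-level , b↾α)
    ... | g , L , anchored = Y , levels , unique-drops , restricts-to-X , b∈Y , consistent
      where
        Y : List Node
        Y = map g (allFin N)

        above : ∀ i → Above i (g i)
        above i = Lift.above L i (toℕ<n i)

        restrict-g : ∀ {i c} → Restr T R (g i) α c → c ≡ a i
        restrict-g {i} g↾α = restrict-unique g↾α (proj₂ (above i))

        levels : ∀ {y} → y ∈ Y → Level T β y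
        levels y∈Y with ∈-map⁻ g y∈Y
        ... | i , _ , refl = proj₁ (above i)

        unique-drops : UniqueDrop T R α Y
        unique-drops y∈Y y′∈Y y↾α y′↾α with ∈-map⁻ g y∈Y | ∈-map⁻ g y′∈Y
        ... | i , _ , refl | i′ , _ , refl =
              cong g (a-injective (trans (sym (restrict-g y↾α)) (restrict-g y′↾α)))

        restricts-to-X : RestrEq T R α Y X
        restricts-to-X c = from-X , to-X
          where
            from-X : c ∈ X → ∃[ y ] (y ∈ Y × Restr T R y α c)
            from-X c∈X with proj₁ (a-enumerates c) c∈X
            ... | i , refl = g i , ∈-map⁺ g (∈-allFin i) , proj₂ (above i)
            to-X : ∃[ y ] (y ∈ Y × Restr T R y α c) → c ∈ X
            to-X (y , y∈Y , y↾α) with ∈-map⁻ g y∈Y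
            ... | i , _ , refl = subst (_∈ X) (sym (restrict-g y↾α)) (a∈X i)

        b∈Y : b ∈ Y
        b∈Y = subst (_∈ Y) (anchored (toℕ<n i₀)) (∈-map⁺ g (∈-allFin i₀))

        consistent : ∀ τ → Consistent T R α (f τ) Y
        consistent τ x∈Y y∈Y x↾α y↾α with ∈-map⁻ g x∈Y | ∈-map⁻ g y∈Y
        ... | p , _ , refl | q , _ , refl with restrict-g x↾α | restrict-g y↾α
        ... | refl | refl =
              Lift.consistent L τ p q (toℕ<n p) (toℕ<n q) ,
              λ gp↦gq → F.restrict-app τ iα (α<ht (proj₁ (above p))) gp↦gq (proj₂ (above p)) (proj₂ (above q))

proposition4p11 : (𝓗 : Heights) →
    let open Heights 𝓗 in
    let open Tree 𝓗 in
    (T : List Node) (R : List (Node × Node)) →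
    IsStdTree T R → IsNormal T R →
    (k : ℕ) (f : Fin k → List (Node × Node)) →
    (∀ ξ → IsStdFun T R (f ξ)) →
    (α β : H) → InHt T α → InHt T β → α < β →
    (X : List Node) → (∀ {x} → x ∈ X → Level T α x) →
    Separated f X →
    (∀ τ {x y} → x ∈ X → y ∈ X → (x , y) ∈ f τ →
    (∀ {z} → (x , z) ∈ R → ∃[ w ] ((z , w) ∈ f τ)) ×
    (∀ {z} → (y , z) ∈ R → ∃[ w ] ((w , z) ∈ f τ))) →
    ∀ b → Level T β b → ∃[ c ] (Restr T R b α c × c ∈ X) →
    ∃[ Y ] ((∀ {y} → y ∈ Y → Level T β y) ×
    UniqueDrop T R α Y ×
    RestrEq T R α Y X ×
    b ∈ Y ×
    (∀ τ → Consistent T R α (f τ) Y))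
proposition4p11 𝓗 T R st normal k f sf α β iα iβ α<β X X-level
                (N , a , a-injective , a-enumerates , separated) succ-in-dom-ran b =
  Lifting.Construction.lifted-level-set 𝓗 T R st normal f sf iα iβ α<β X X-level
    succ-in-dom-ran a a-enumerates separated a-injective
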